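{- For every formula $A$ of $\mathbf{EQC}$, if $\vdash_{\mathbf{EQC}}A$ then $\vdash_{\mathbf{IQC}}A^F$. Likewise, for every formula $A$ of the language of $\mathbf{EA}$, if $\vdash_{\mathbf{EA}}A$ then $\vdash_{\mathbf{HA}}A^F$.
   Context: $\mathbf{IQC}$ is intuitionistic first-order predicate calculus with equality, primitives $\vee,\wedge,\supset,\exists,\forall,\bot$; $\neg A:=A\supset\bot$, $\neg^2A:=\neg\neg A$. $\mathbf{EQC}$ is classical first-order predicate calculus with equality plus a modal operator $\Box$ with S4 rules (no Barcan formula). $\mathbf{HA}$ is Heyting arithmetic; $\mathbf{EA}$ is Peano arithmetic with induction for all formulas of the modal language over $\mathbf{EQC}$. Translation $A^F$: $A^F=\neg^2A$ for atomic $A$; $(A\vee B)^F=\neg^2(A^F\vee B^F)$; $(A\wedge B)^F=A^F\wedge B^F$; $(A\supset B)^F=A^F\supset B^F$; $(\Box A)^F=A^F$; $(\exists xA)^F=\neg^2\exists xA^F$; $(\forall xA)^F=\forall xA^F$. -}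

module Defs where

open import Data.Nat using (ℕ; zero; suc)
open import Data.Fin using (Fin; zero; suc)
open import Data.Vec using (Vec; []; _∷_)
open import Data.Empty using (⊥)

-- First-order signatures (function and relation symbols with arities).
-- Equality is a logical primitive, not a relation symbol.

record Signature : Set₁ where
  field
    Fun   : Set
    funAr : Fun → ℕ
    Rel   : Set
    relAr : Rel → ℕ

-- Two languages: the non-modal one (IQC, HA) and the modal one (EQC, EA).
data Mode : Set where
  nonmodal modal : Mode

module Syntax (Σ : Signature) where
  open Signature Σ

  data Term (n : ℕ) : Set where
    var : Fin n → Term n
    fun : (f : Fun) → Vec (Term n) (funAr f) → Term n

  mutual
    substT : ∀ {n m} → (Fin n → Term m) → Term n → Term m
    substT σ (var i)    = σ i
    substT σ (fun f ts) = fun f (substTs σ ts)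

    substTs : ∀ {n m k} → (Fin n → Term m) → Vec (Term n) k → Vec (Term m) k
    substTs σ []       = []
    substTs σ (t ∷ ts) = substT σ t ∷ substTs σ ts

  wkT : ∀ {n} → Term n → Term (suc n)
  wkT = substT (λ i → var (suc i))

  lift : ∀ {n m} → (Fin n → Term m) → Fin (suc n) → Term (suc m)
  lift σ zero    = var zero
  lift σ (suc i) = wkT (σ i)

  infixr 5 _⊃_
  infixr 6 _∨_
  infixr 7 _∧_
  infix  8 _≐_
  data Form : Mode → ℕ → Set where
    rel  : ∀ {μ n} (r : Rel) → Vec (Term n) (relAr r) → Form μ n
    _≐_  : ∀ {μ n} → Term n → Term n → Form μ n
    ⊥'   : ∀ {μ n} → Form μ n
    _∨_  : ∀ {μ n} → Form μ n → Form μ n → Form μ n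
    _∧_  : ∀ {μ n} → Form μ n → Form μ n → Form μ n
    _⊃_  : ∀ {μ n} → Form μ n → Form μ n → Form μ n
    ∃'   : ∀ {μ n} → Form μ (suc n) → Form μ n
    ∀'   : ∀ {μ n} → Form μ (suc n) → Form μ n
    □    : ∀ {n} → Form modal n → Form modal n

  ¬' : ∀ {μ n} → Form μ n → Form μ n
  ¬' A = A ⊃ ⊥'

  ¬¬ : ∀ {μ n} → Form μ n → Form μ n
  ¬¬ A = ¬' (¬' A)

  sub : ∀ {μ n m} → (Fin n → Term m) → Form μ n → Form μ m
  sub σ (rel r ts) = rel r (substTs σ ts)
  sub σ (t ≐ s)    = substT σ t ≐ substT σ s
  sub σ ⊥'         = ⊥'
  sub σ (A ∨ B)    = sub σ A ∨ sub σ B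
  sub σ (A ∧ B)    = sub σ A ∧ sub σ B
  sub σ (A ⊃ B)    = sub σ A ⊃ sub σ B
  sub σ (∃' A)     = ∃' (sub (lift σ) A)
  sub σ (∀' A)     = ∀' (sub (lift σ) A)
  sub σ (□ A)      = □ (sub σ A)

  -- weakening (the variable 0 does not occur free in wk C)
  wk : ∀ {μ n} → Form μ n → Form μ (suc n)
  wk = sub (λ i → var (suc i))

  inst : ∀ {n} → Term n → Fin (suc n) → Term n
  inst t zero    = t
  inst t (suc i) = var i

  _[_] : ∀ {μ n} → Form μ (suc n) → Term n → Form μ n
  A [ t ] = sub (inst t) A

  -- the translation A ↦ A^F (⊥ is treated as atomic)
  F : ∀ {n} → Form modal n → Form nonmodal n
  F (rel r ts) = ¬¬ (rel r ts)
  F (t ≐ s)    = ¬¬ (t ≐ s)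
  F ⊥'         = ¬¬ ⊥'
  F (A ∨ B)    = ¬¬ (F A ∨ F B)
  F (A ∧ B)    = F A ∧ F B
  F (A ⊃ B)    = F A ⊃ F B
  F (∃' A)     = ¬¬ (∃' (F A))
  F (∀' A)     = ∀' (F A)
  F (□ A)      = F A

  Axioms : Mode → Set₁
  Axioms μ = ∀ {n} → Form μ n → Set

  noAxioms : ∀ {μ} → Axioms μ
  noAxioms _ = ⊥

  data IQC⊢ (Ax : Axioms nonmodal) : ∀ {n} → Form nonmodal n → Set where
    ax   : ∀ {n} {A : Form nonmodal n} → Ax A → IQC⊢ Ax A
    mp   : ∀ {n} {A B : Form nonmodal n} → IQC⊢ Ax (A ⊃ B) → IQC⊢ Ax A → IQC⊢ Ax B
    axK  : ∀ {n} {A B : Form nonmodal n} → IQC⊢ Ax (A ⊃ B ⊃ A)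
    axS  : ∀ {n} {A B C : Form nonmodal n} → IQC⊢ Ax ((A ⊃ B ⊃ C) ⊃ (A ⊃ B) ⊃ A ⊃ C)
    ∧I   : ∀ {n} {A B : Form nonmodal n} → IQC⊢ Ax (A ⊃ B ⊃ A ∧ B)
    ∧E₁  : ∀ {n} {A B : Form nonmodal n} → IQC⊢ Ax (A ∧ B ⊃ A)
    ∧E₂  : ∀ {n} {A B : Form nonmodal n} → IQC⊢ Ax (A ∧ B ⊃ B)
    ∨I₁  : ∀ {n} {A B : Form nonmodal n} → IQC⊢ Ax (A ⊃ A ∨ B)
    ∨I₂  : ∀ {n} {A B : Form nonmodal n} → IQC⊢ Ax (B ⊃ A ∨ B)
    ∨E   : ∀ {n} {A B C : Form nonmodal n} → IQC⊢ Ax ((A ⊃ C) ⊃ (B ⊃ C) ⊃ A ∨ B ⊃ C)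
    ⊥E   : ∀ {n} {A : Form nonmodal n} → IQC⊢ Ax (⊥' ⊃ A)
    ∀E   : ∀ {n} {A : Form nonmodal (suc n)} (t : Term n) → IQC⊢ Ax (∀' A ⊃ A [ t ])
    ∃I   : ∀ {n} {A : Form nonmodal (suc n)} (t : Term n) → IQC⊢ Ax (A [ t ] ⊃ ∃' A)
    ∀R   : ∀ {n} {C : Form nonmodal n} {A : Form nonmodal (suc n)} →
           IQC⊢ Ax (wk C ⊃ A) → IQC⊢ Ax (C ⊃ ∀' A)
    ∃R   : ∀ {n} {C : Form nonmodal n} {A : Form nonmodal (suc n)} →
           IQC⊢ Ax (A ⊃ wk C) → IQC⊢ Ax (∃' A ⊃ C)
    eqRefl : ∀ {n} (t : Term n) → IQC⊢ Ax (t ≐ t)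
    eqSub  : ∀ {n} {A : Form nonmodal (suc n)} (t s : Term n) →
             IQC⊢ Ax (t ≐ s ⊃ A [ t ] ⊃ A [ s ])

  -- Classical predicate calculus with equality plus S4 for □ (no Barcan
  -- formula), over the modal language, with extra axioms Ax.
  data EQC⊢ (Ax : Axioms modal) : ∀ {n} → Form modal n → Set where
    ax   : ∀ {n} {A : Form modal n} → Ax A → EQC⊢ Ax A
    mp   : ∀ {n} {A B : Form modal n} → EQC⊢ Ax (A ⊃ B) → EQC⊢ Ax A → EQC⊢ Ax B
    axK  : ∀ {n} {A B : Form modal n} → EQC⊢ Ax (A ⊃ B ⊃ A)
    axS  : ∀ {n} {A B C : Form modal n} → EQC⊢ Ax ((A ⊃ B ⊃ C) ⊃ (A ⊃ B) ⊃ A ⊃ C)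
    ∧I   : ∀ {n} {A B : Form modal n} → EQC⊢ Ax (A ⊃ B ⊃ A ∧ B)
    ∧E₁  : ∀ {n} {A B : Form modal n} → EQC⊢ Ax (A ∧ B ⊃ A)
    ∧E₂  : ∀ {n} {A B : Form modal n} → EQC⊢ Ax (A ∧ B ⊃ B)
    ∨I₁  : ∀ {n} {A B : Form modal n} → EQC⊢ Ax (A ⊃ A ∨ B)
    ∨I₂  : ∀ {n} {A B : Form modal n} → EQC⊢ Ax (B ⊃ A ∨ B)
    ∨E   : ∀ {n} {A B C : Form modal n} → EQC⊢ Ax ((A ⊃ C) ⊃ (B ⊃ C) ⊃ A ∨ B ⊃ C)
    ⊥E   : ∀ {n} {A : Form modal n} → EQC⊢ Ax (⊥' ⊃ A)
    lem  : ∀ {n} {A : Form modal n} → EQC⊢ Ax (A ∨ ¬' A)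
    ∀E   : ∀ {n} {A : Form modal (suc n)} (t : Term n) → EQC⊢ Ax (∀' A ⊃ A [ t ])
    ∃I   : ∀ {n} {A : Form modal (suc n)} (t : Term n) → EQC⊢ Ax (A [ t ] ⊃ ∃' A)
    ∀R   : ∀ {n} {C : Form modal n} {A : Form modal (suc n)} →
           EQC⊢ Ax (wk C ⊃ A) → EQC⊢ Ax (C ⊃ ∀' A)
    ∃R   : ∀ {n} {C : Form modal n} {A : Form modal (suc n)} →
           EQC⊢ Ax (A ⊃ wk C) → EQC⊢ Ax (∃' A ⊃ C)
    eqRefl : ∀ {n} (t : Term n) → EQC⊢ Ax (t ≐ t)
    eqSub  : ∀ {n} {A : Form modal (suc n)} (t s : Term n) →
             EQC⊢ Ax (t ≐ s ⊃ A [ t ] ⊃ A [ s ])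
    □K   : ∀ {n} {A B : Form modal n} → EQC⊢ Ax (□ (A ⊃ B) ⊃ □ A ⊃ □ B)
    □T   : ∀ {n} {A : Form modal n} → EQC⊢ Ax (□ A ⊃ A)
    □4   : ∀ {n} {A : Form modal n} → EQC⊢ Ax (□ A ⊃ □ (□ A))
    nec  : ∀ {n} {A : Form modal n} → EQC⊢ Ax A → EQC⊢ Ax (□ A)

  IQC-proves : ∀ {n} → Form nonmodal n → Set
  IQC-proves = IQC⊢ noAxioms

  EQC-proves : ∀ {n} → Form modal n → Set
  EQC-proves = EQC⊢ noAxioms

data ArFun : Set where
  zeroF succF plusF timesF : ArFun

arAr : ArFun → ℕ
arAr zeroF  = 0
arAr succF  = 1
arAr plusF  = 2
arAr timesF = 2

ArSig : Signature
ArSig = record { Fun = ArFun ; funAr = arAr ; Rel = ⊥ ; relAr = λ () }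

module Arith where
  open Syntax ArSig public

  `0 : ∀ {n} → Term n
  `0 = fun zeroF []

  `S : ∀ {n} → Term n → Term n
  `S t = fun succF (t ∷ [])

  _`+_ : ∀ {n} → Term n → Term n → Term n
  t `+ s = fun plusF (t ∷ s ∷ [])

  _`·_ : ∀ {n} → Term n → Term n → Term n
  t `· s = fun timesF (t ∷ s ∷ [])

  succSub : ∀ {n} → Fin (suc n) → Term (suc n)
  succSub zero    = `S (var zero)
  succSub (suc i) = var (suc i)

  -- arithmetic axioms, with induction for all formulas of the language μ
  data PAAx {μ : Mode} : ∀ {n} → Form μ n → Set where
    S≢0   : ∀ {n} (t : Term n) → PAAx (¬' (`S t ≐ `0))
    S-inj : ∀ {n} (t s : Term n) → PAAx (`S t ≐ `S s ⊃ t ≐ s)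
    +-0   : ∀ {n} (t : Term n) → PAAx (t `+ `0 ≐ t)
    +-S   : ∀ {n} (t s : Term n) → PAAx (t `+ `S s ≐ `S (t `+ s))
    ·-0   : ∀ {n} (t : Term n) → PAAx (t `· `0 ≐ `0)
    ·-S   : ∀ {n} (t s : Term n) → PAAx (t `· `S s ≐ (t `· s) `+ t)
    ind   : ∀ {n} (A : Form μ (suc n)) →
            PAAx (A [ `0 ] ∧ ∀' (A ⊃ sub succSub A) ⊃ ∀' A)

  HA-proves : ∀ {n} → Form nonmodal n → Set
  HA-proves = IQC⊢ PAAx

  EA-proves : ∀ {n} → Form modal n → Set
  EA-proves = EQC⊢ PAAx

{-# OPTIONS --safe #-}
module Submission where

-- Every translation A^F is ¬¬-stable in IQC (atoms, ∨ and ∃ are ¬¬-prefixed, and stability is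
-- preserved by ∧, ⊃ and ∀).  So the classical principles of EQC — excluded middle, ∨- and
-- ∃-elimination into an arbitrary formula, substitution of equals — translate into intuitionistic
-- theorems, while □ is erased, turning the S4 axioms into identities and necessitation into
-- nothing.  Since F commutes with substitution, the same holds over any set of axioms whose
-- translations are derivable; for arithmetic, the translated Peano axioms follow from their
-- HA versions and translated induction is induction for F A.

open import Data.Nat using (ℕ; zero; suc)
open import Data.Fin using (Fin; zero; suc)
open import Data.Vec using (Vec; []; _∷_)
open import Data.List using (List; []; _∷_)
open import Data.List.Membership.Propositional using (_∈_)
open import Data.List.Relation.Unary.Any using (here; there)
open import Data.Product using (_×_; _,_)
open import Relation.Binary.PropositionalEquality using (_≡_; refl; sym; trans; cong; cong₂; subst; subst₂)
open import Defs

module Substitution (Σ : Signature) where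
  open Syntax Σ

  Sub : ℕ → ℕ → Set
  Sub n m = Fin n → Term m

  infix 4 _≗_
  infixr 9 _⊙_

  _≗_ : ∀ {n m} → Sub n m → Sub n m → Set
  σ ≗ τ = ∀ i → σ i ≡ τ i

  _⊙_ : ∀ {n m k} → Sub m k → Sub n m → Sub n k
  (σ ⊙ τ) i = substT σ (τ i)

  wkS : ∀ {n} → Sub n (suc n)
  wkS i = var (suc i)

  mutual
    substT-cong : ∀ {n m} {σ τ : Sub n m} → σ ≗ τ → (t : Term n) → substT σ t ≡ substT τ t
    substT-cong e (var i)    = e i
    substT-cong e (fun f ts) = cong (fun f) (substTs-cong e ts)

    substTs-cong : ∀ {n m k} {σ τ : Sub n m} → σ ≗ τ →
                   (ts : Vec (Term n) k) → substTs σ ts ≡ substTs τ ts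
    substTs-cong e []       = refl
    substTs-cong e (t ∷ ts) = cong₂ _∷_ (substT-cong e t) (substTs-cong e ts)

  mutual
    substT-⊙ : ∀ {n m k} (σ : Sub m k) (τ : Sub n m) (t : Term n) →
               substT σ (substT τ t) ≡ substT (σ ⊙ τ) t
    substT-⊙ σ τ (var i)    = refl
    substT-⊙ σ τ (fun f ts) = cong (fun f) (substTs-⊙ σ τ ts)

    substTs-⊙ : ∀ {n m k j} (σ : Sub m k) (τ : Sub n m) (ts : Vec (Term n) j) →
                substTs σ (substTs τ ts) ≡ substTs (σ ⊙ τ) ts
    substTs-⊙ σ τ []       = refl
    substTs-⊙ σ τ (t ∷ ts) = cong₂ _∷_ (substT-⊙ σ τ t) (substTs-⊙ σ τ ts)

  mutual
    substT-var : ∀ {n} (t : Term n) → substT var t ≡ t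
    substT-var (var i)    = refl
    substT-var (fun f ts) = cong (fun f) (substTs-var ts)

    substTs-var : ∀ {n k} (ts : Vec (Term n) k) → substTs var ts ≡ ts
    substTs-var []       = refl
    substTs-var (t ∷ ts) = cong₂ _∷_ (substT-var t) (substTs-var ts)

  lift-cong : ∀ {n m} {σ τ : Sub n m} → σ ≗ τ → lift σ ≗ lift τ
  lift-cong e zero    = refl
  lift-cong e (suc i) = cong wkT (e i)

  lift-⊙ : ∀ {n m k} (σ : Sub m k) (τ : Sub n m) → lift σ ⊙ lift τ ≗ lift (σ ⊙ τ)
  lift-⊙ σ τ zero    = refl
  lift-⊙ σ τ (suc i) = trans (substT-⊙ (lift σ) wkS (τ i)) (sym (substT-⊙ wkS σ (τ i)))

  lift-var : ∀ {n} → lift (var {n}) ≗ var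
  lift-var zero    = refl
  lift-var (suc i) = refl

  sub-cong : ∀ {μ n m} {σ τ : Sub n m} → σ ≗ τ → (A : Form μ n) → sub σ A ≡ sub τ A
  sub-cong e (rel r ts) = cong (rel r) (substTs-cong e ts)
  sub-cong e (t ≐ s)    = cong₂ _≐_ (substT-cong e t) (substT-cong e s)
  sub-cong e ⊥'         = refl
  sub-cong e (A ∨ B)    = cong₂ _∨_ (sub-cong e A) (sub-cong e B)
  sub-cong e (A ∧ B)    = cong₂ _∧_ (sub-cong e A) (sub-cong e B)
  sub-cong e (A ⊃ B)    = cong₂ _⊃_ (sub-cong e A) (sub-cong e B)
  sub-cong e (∃' A)     = cong ∃' (sub-cong (lift-cong e) A)
  sub-cong e (∀' A)     = cong ∀' (sub-cong (lift-cong e) A)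
  sub-cong e (□ A)      = cong □ (sub-cong e A)

  sub-⊙ : ∀ {μ n m k} (σ : Sub m k) (τ : Sub n m) (A : Form μ n) →
          sub σ (sub τ A) ≡ sub (σ ⊙ τ) A
  sub-⊙ σ τ (rel r ts) = cong (rel r) (substTs-⊙ σ τ ts)
  sub-⊙ σ τ (t ≐ s)    = cong₂ _≐_ (substT-⊙ σ τ t) (substT-⊙ σ τ s)
  sub-⊙ σ τ ⊥'         = refl
  sub-⊙ σ τ (A ∨ B)    = cong₂ _∨_ (sub-⊙ σ τ A) (sub-⊙ σ τ B)
  sub-⊙ σ τ (A ∧ B)    = cong₂ _∧_ (sub-⊙ σ τ A) (sub-⊙ σ τ B)
  sub-⊙ σ τ (A ⊃ B)    = cong₂ _⊃_ (sub-⊙ σ τ A) (sub-⊙ σ τ B)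
  sub-⊙ σ τ (∃' A)     = cong ∃' (trans (sub-⊙ (lift σ) (lift τ) A) (sub-cong (lift-⊙ σ τ) A))
  sub-⊙ σ τ (∀' A)     = cong ∀' (trans (sub-⊙ (lift σ) (lift τ) A) (sub-cong (lift-⊙ σ τ) A))
  sub-⊙ σ τ (□ A)      = cong □ (sub-⊙ σ τ A)

  sub-var : ∀ {μ n} (A : Form μ n) → sub var A ≡ A
  sub-var (rel r ts) = cong (rel r) (substTs-var ts)
  sub-var (t ≐ s)    = cong₂ _≐_ (substT-var t) (substT-var s)
  sub-var ⊥'         = refl
  sub-var (A ∨ B)    = cong₂ _∨_ (sub-var A) (sub-var B)
  sub-var (A ∧ B)    = cong₂ _∧_ (sub-var A) (sub-var B)
  sub-var (A ⊃ B)    = cong₂ _⊃_ (sub-var A) (sub-var B)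
  sub-var (∃' A)     = cong ∃' (trans (sub-cong lift-var A) (sub-var A))
  sub-var (∀' A)     = cong ∀' (trans (sub-cong lift-var A) (sub-var A))
  sub-var (□ A)      = cong □ (sub-var A)

  inst-var-zero-lift-wkS : ∀ {n} → inst (var zero) ⊙ lift (wkS {n}) ≗ var
  inst-var-zero-lift-wkS zero    = refl
  inst-var-zero-lift-wkS (suc i) = refl

  lift-wkS-[var-zero] : ∀ {μ n} (A : Form μ (suc n)) → sub (lift wkS) A [ var zero ] ≡ A
  lift-wkS-[var-zero] A =
    trans (sub-⊙ (inst (var zero)) (lift wkS) A)
          (trans (sub-cong inst-var-zero-lift-wkS A) (sub-var A))

  F-sub : ∀ {n m} (σ : Sub n m) (A : Form modal n) → F (sub σ A) ≡ sub σ (F A)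
  F-sub σ (rel r ts) = refl
  F-sub σ (t ≐ s)    = refl
  F-sub σ ⊥'         = refl
  F-sub σ (A ∨ B)    = cong₂ (λ X Y → ¬¬ (X ∨ Y)) (F-sub σ A) (F-sub σ B)
  F-sub σ (A ∧ B)    = cong₂ _∧_ (F-sub σ A) (F-sub σ B)
  F-sub σ (A ⊃ B)    = cong₂ _⊃_ (F-sub σ A) (F-sub σ B)
  F-sub σ (∃' A)     = cong (λ X → ¬¬ (∃' X)) (F-sub (lift σ) A)
  F-sub σ (∀' A)     = cong ∀' (F-sub (lift σ) A)
  F-sub σ (□ A)      = F-sub σ A

module Intuitionistic (Σ : Signature) (Ax : Syntax.Axioms Σ nonmodal) where
  open Syntax Σ
  open Substitution Σ

  Fm : ℕ → Set
  Fm = Form nonmodal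

  ⊢_ : ∀ {n} → Fm n → Set
  ⊢ A = IQC⊢ Ax A

  -- Derivations from hypotheses, with the deduction theorem `lam` proved by bracket abstraction;
  -- this lets the Hilbert-style theorems below be written as λ-terms.
  data _⊩_ {n} (Γ : List (Fm n)) : Fm n → Set where
    thm : ∀ {A} → ⊢ A → Γ ⊩ A
    hyp : ∀ {A} → A ∈ Γ → Γ ⊩ A
    app : ∀ {A B} → Γ ⊩ (A ⊃ B) → Γ ⊩ A → Γ ⊩ B

  ⊃-refl : ∀ {n} {A : Fm n} → ⊢ (A ⊃ A)
  ⊃-refl {A = A} = mp (mp axS axK) (axK {B = A ⊃ A})

  lam : ∀ {n} {Γ : List (Fm n)} {A B} → (A ∷ Γ) ⊩ B → Γ ⊩ (A ⊃ B)
  lam (thm p)            = thm (mp axK p)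
  lam (hyp (here refl))  = thm ⊃-refl
  lam (hyp (there x))    = app (thm axK) (hyp x)
  lam (app f a)          = app (app (thm axS) (lam f)) (lam a)

  closed : ∀ {n} {A : Fm n} → [] ⊩ A → ⊢ A
  closed (thm p)   = p
  closed (hyp ())
  closed (app f a) = mp (closed f) (closed a)

  #0 : ∀ {n} {Γ : List (Fm n)} {A} → (A ∷ Γ) ⊩ A
  #0 = hyp (here refl)

  #1 : ∀ {n} {Γ : List (Fm n)} {A B} → (B ∷ A ∷ Γ) ⊩ A
  #1 = hyp (there (here refl))

  #2 : ∀ {n} {Γ : List (Fm n)} {A B C} → (C ∷ B ∷ A ∷ Γ) ⊩ A
  #2 = hyp (there (there (here refl)))

  #3 : ∀ {n} {Γ : List (Fm n)} {A B C D} → (D ∷ C ∷ B ∷ A ∷ Γ) ⊩ A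
  #3 = hyp (there (there (there (here refl))))

  #4 : ∀ {n} {Γ : List (Fm n)} {A B C D E} → (E ∷ D ∷ C ∷ B ∷ A ∷ Γ) ⊩ A
  #4 = hyp (there (there (there (there (here refl)))))

  ⊃-trans : ∀ {n} {A B C : Fm n} → ⊢ (A ⊃ B) → ⊢ (B ⊃ C) → ⊢ (A ⊃ C)
  ⊃-trans p q = closed (lam (app (thm q) (app (thm p) #0)))

  ¬¬-intro : ∀ {n} {A : Fm n} → ⊢ (A ⊃ ¬¬ A)
  ¬¬-intro = closed (lam (lam (app #0 #1)))

  ¬¬-map : ∀ {n} {A B : Fm n} → ⊢ (A ⊃ B) → ⊢ (¬¬ A ⊃ ¬¬ B)
  ¬¬-map p = closed (lam (lam (app #1 (lam (app #1 (app (thm p) #0))))))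

  ¬¬⊥-elim : ∀ {n} {A : Fm n} → ⊢ (¬¬ ⊥' ⊃ A)
  ¬¬⊥-elim = closed (lam (app (thm ⊥E) (app #0 (thm ⊃-refl))))

  ¬¬-excluded-middle : ∀ {n} {A B : Fm n} → ⊢ ¬¬ (A ∨ (A ⊃ B))
  ¬¬-excluded-middle =
    closed (lam (app #0 (app (thm ∨I₂) (lam (app (thm ⊥E) (app #1 (app (thm ∨I₁) #0)))))))

  Stable : ∀ {n} → Fm n → Set
  Stable A = ⊢ (¬¬ A ⊃ A)

  ¬¬-stable : ∀ {n} {A : Fm n} → Stable (¬¬ A)
  ¬¬-stable = closed (lam (lam (app #1 (lam (app #0 #1)))))

  ∧-stable : ∀ {n} {A B : Fm n} → Stable A → Stable B → Stable (A ∧ B)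
  ∧-stable sA sB = closed (lam (app (app (thm ∧I) (app (thm sA) (app (thm (¬¬-map ∧E₁)) #0)))
                                                  (app (thm sB) (app (thm (¬¬-map ∧E₂)) #0))))

  ⊃-stable : ∀ {n} {A B : Fm n} → Stable B → Stable (A ⊃ B)
  ⊃-stable sB = closed (lam (lam (app (thm sB) (lam (app #2 (lam (app #1 (app #0 #2))))))))

  ∀-stable : ∀ {n} {A : Fm (suc n)} → Stable A → Stable (∀' A)
  ∀-stable {A = A} sA = ∀R (⊃-trans (¬¬-map ∀-instance) sA)
    where
    ∀-instance : ⊢ (wk (∀' A) ⊃ A)
    ∀-instance = subst (λ B → ⊢ (wk (∀' A) ⊃ B)) (lift-wkS-[var-zero] A) (∀E (var zero))

  ¬¬-bind : ∀ {n} {A C : Fm n} → Stable C → ⊢ (A ⊃ C) → ⊢ (¬¬ A ⊃ C)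
  ¬¬-bind sC p = ⊃-trans (¬¬-map p) sC

  ¬¬∨-elim : ∀ {n} {A B C : Fm n} → Stable C → ⊢ ((A ⊃ C) ⊃ (B ⊃ C) ⊃ ¬¬ (A ∨ B) ⊃ C)
  ¬¬∨-elim sC = closed (lam (lam (lam (app (thm sC)
                  (lam (app #1 (lam (app #1 (app (app (app (thm ∨E) #4) #3) #0)))))))))

  F-stable : ∀ {n} (A : Form modal n) → Stable (F A)
  F-stable (rel r ts) = ¬¬-stable
  F-stable (t ≐ s)    = ¬¬-stable
  F-stable ⊥'         = ¬¬-stable
  F-stable (A ∨ B)    = ¬¬-stable
  F-stable (A ∧ B)    = ∧-stable (F-stable A) (F-stable B)
  F-stable (A ⊃ B)    = ⊃-stable (F-stable B)
  F-stable (∃' A)     = ¬¬-stable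
  F-stable (∀' A)     = ∀-stable (F-stable A)
  F-stable (□ A)      = F-stable A

  module _ (AxM : Axioms modal) (F-axiom : ∀ {n} {A : Form modal n} → AxM A → ⊢ F A) where

    F-sound : ∀ {n} {A : Form modal n} → EQC⊢ AxM A → ⊢ F A
    F-sound (ax a)                = F-axiom a
    F-sound (mp p q)              = mp (F-sound p) (F-sound q)
    F-sound axK                   = axK
    F-sound axS                   = axS
    F-sound ∧I                    = ∧I
    F-sound ∧E₁                   = ∧E₁
    F-sound ∧E₂                   = ∧E₂
    F-sound ∨I₁                   = ⊃-trans ∨I₁ ¬¬-intro
    F-sound ∨I₂                   = ⊃-trans ∨I₂ ¬¬-intro
    F-sound (∨E {C = C})          = ¬¬∨-elim (F-stable C)
    F-sound ⊥E                    = ¬¬⊥-elim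
    F-sound lem                   = ¬¬-excluded-middle
    F-sound (∀E {A = A} t)        =
      subst (λ B → ⊢ (∀' (F A) ⊃ B)) (sym (F-sub (inst t) A)) (∀E t)
    F-sound (∃I {A = A} t)        =
      ⊃-trans (subst (λ B → ⊢ (B ⊃ ∃' (F A))) (sym (F-sub (inst t) A)) (∃I t)) ¬¬-intro
    F-sound (∀R {C = C} {A = A} p) =
      ∀R (subst (λ B → ⊢ (B ⊃ F A)) (F-sub wkS C) (F-sound p))
    F-sound (∃R {C = C} {A = A} p) =
      ¬¬-bind (F-stable C) (∃R (subst (λ B → ⊢ (F A ⊃ B)) (F-sub wkS C) (F-sound p)))
    F-sound (eqRefl t)            = mp ¬¬-intro (eqRefl t)
    F-sound (eqSub {A = A} t s)   =
      ¬¬-bind (F-stable (A [ t ] ⊃ A [ s ]))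
        (subst₂ (λ B C → ⊢ (t ≐ s ⊃ B ⊃ C)) (sym (F-sub (inst t) A)) (sym (F-sub (inst s) A))
                (eqSub t s))
    F-sound □K                    = ⊃-refl
    F-sound □T                    = ⊃-refl
    F-sound □4                    = ⊃-refl
    F-sound (nec p)               = F-sound p

EQC⇒IQC-F : (Σ : Signature) → ∀ {n} (A : Syntax.Form Σ modal n) →
            Syntax.EQC-proves Σ A → Syntax.IQC-proves Σ (Syntax.F Σ A)
EQC⇒IQC-F Σ A = Intuitionistic.F-sound Σ noAxioms noAxioms (λ ())
  where open Syntax Σ using (noAxioms)

module _ where
  open Arith
  open Substitution ArSig
  open Intuitionistic ArSig PAAx

  PAAx-F : ∀ {n} {A : Form modal n} → PAAx A → HA-proves (F A)
  PAAx-F (S≢0 t)     = ¬¬-map (ax (S≢0 t))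
  PAAx-F (S-inj t s) = ¬¬-map (ax (S-inj t s))
  PAAx-F (+-0 t)     = mp ¬¬-intro (ax (+-0 t))
  PAAx-F (+-S t s)   = mp ¬¬-intro (ax (+-S t s))
  PAAx-F (·-0 t)     = mp ¬¬-intro (ax (·-0 t))
  PAAx-F (·-S t s)   = mp ¬¬-intro (ax (·-S t s))
  PAAx-F (ind A) rewrite F-sub (inst `0) A | F-sub succSub A = ax (ind (F A))

  EA⇒HA-F : ∀ {n} (A : Form modal n) → EA-proves A → HA-proves (F A)
  EA⇒HA-F A = F-sound PAAx PAAx-F

corollary4p1 : ((Σ : Signature) → ∀ {n : ℕ} (A : Syntax.Form Σ modal n) →
                   Syntax.EQC-proves Σ A → Syntax.IQC-proves Σ (Syntax.F Σ A))
               × (∀ {n : ℕ} (A : Arith.Form modal n) →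
                   Arith.EA-proves A → Arith.HA-proves (Arith.F A))
corollary4p1 = EQC⇒IQC-F , EA⇒HA-F
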